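{- Let $G$ be a graph without isolated vertices, and let $G_1,G_2,\dots,G_{\omega}$ be all the connected components of $G$. Then \[ \max_{1\leq i\leq \omega}\chi_d^t(G_i)+2\omega-2\ \leq\ \chi_d^t(G)\ \leq\ \sum_{i=1}^{\omega}\chi_d^t(G_i). \]
   Context: All graphs are finite, simple and undirected. A total dominator coloring of a graph $G$ is a proper vertex coloring of $G$ in which each vertex of $G$ is adjacent to every vertex of some color class (a color class is the set of all vertices receiving a given color). The total dominator chromatic number $\chi_d^t(G)$ is the minimum number of color classes in a total dominator coloring of $G$. -}

module Defs where

open import Data.Nat using (ℕ; zero; suc; _+_; _⊔_)
open import Data.Fin using (Fin; zero; suc)
open import Data.Fin.Subset using (Subset; _∈_; ⊤)
open import Data.Product using (Σ; ∃; ∃-syntax; _×_; _,_)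
open import Relation.Nullary using (¬_; Dec)
open import Relation.Binary.PropositionalEquality using (_≡_; _≢_)
open import Data.Nat using (_≤_)

record Graph (n : ℕ) : Set₁ where
  field
    Adj    : Fin n → Fin n → Set
    adj?   : ∀ u v → Dec (Adj u v)
    sym    : ∀ {u v} → Adj u v → Adj v u
    irrefl : ∀ {u} → ¬ Adj u u
open Graph public

module _ {n : ℕ} (G : Graph n) where

  NoIsolated : Set
  NoIsolated = ∀ v → ∃[ u ] Adj G v u

  data Reach : Fin n → Fin n → Set where
    here : ∀ {v} → Reach v v
    step : ∀ {v w u} → Adj G v w → Reach w u → Reach v u

  IsComponent : Subset n → Set
  IsComponent S = ∃[ v ] (∀ u → (u ∈ S → Reach v u) × (Reach v u → u ∈ S))

  AllComponents : (ω : ℕ) → (Fin ω → Subset n) → Set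
  AllComponents ω comp =
    (∀ i → IsComponent (comp i))
    × (∀ i j → comp i ≡ comp j → i ≡ j)
    × (∀ S → IsComponent S → ∃[ i ] comp i ≡ S)

  -- c is a total dominator coloring with exactly k (nonempty) color classes
  -- of the induced subgraph G[S]; colours are Fin k, every colour is used on S.
  record IsTDC (S : Subset n) (k : ℕ) (c : Fin n → Fin k) : Set where
    field
      proper    : ∀ u v → u ∈ S → v ∈ S → Adj G u v → c u ≢ c v
      surj      : ∀ j → ∃[ u ] (u ∈ S × c u ≡ j)
      dominates : ∀ v → v ∈ S → ∃[ j ] (∀ u → u ∈ S → c u ≡ j → Adj G v u)

  HasTDC : Subset n → ℕ → Set
  HasTDC S k = ∃[ c ] IsTDC S k c

  IsTDChromatic : Subset n → ℕ → Set
  IsTDChromatic S χ = HasTDC S χ × (∀ k → HasTDC S k → χ ≤ k)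

  IsTDChromaticG : ℕ → Set
  IsTDChromaticG = IsTDChromatic ⊤

-- max and sum of a finite family of naturals (max over the empty family is 0).
maxF : ∀ {ω} → (Fin ω → ℕ) → ℕ
maxF {zero}  f = 0
maxF {suc ω} f = f zero ⊔ maxF (λ i → f (suc i))

sumF : ∀ {ω} → (Fin ω → ℕ) → ℕ
sumF {zero}  f = 0
sumF {suc ω} f = f zero + sumF (λ i → f (suc i))

module Submission where

-- Upper bound: colourings of the components with pairwise disjoint palettes
-- glue to a total dominator colouring (TDC) of G; the palettes are the blocks
-- of Fin (sumF χs), via the encoding 'encodeΣ' of pairs (component, colour).
--
-- Lower bound: in a TDC c of G every colour class dominated by a vertex lies in
-- that vertex's component.  Hence each component owns two distinct "private"
-- colours (the class a dominated by one of its vertices, and the class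
-- dominated by a vertex of colour a).  Restricting c to a component G_m gives a
-- "loose" TDC of G_m (proper, every vertex dominates a nonempty class, but
-- colours may be unused) in which the 2(ω - 1) private colours of the other
-- components are unused.  Deleting unused colours ('Loose.shrink') turns it into
-- a genuine TDC of G_m with at most χ - 2(ω - 1) colours.  Choosing m with
-- χ(G_m) maximal gives the lower bound.

open import Defs
open import Data.Nat using (ℕ; zero; suc; _+_; _*_; _≤_; z≤n)
open import Data.Nat.Properties
  using (≤-refl; ≤-trans; ≤-reflexive; +-suc; +-identityʳ; +-monoˡ-≤; m≤n⇒m≤1+n; ⊔-sel; ⊔-identityʳ;
         module ≤-Reasoning)
open import Data.Nat.Solver using (module +-*-Solver)
open import Data.Fin using (Fin; zero; suc; punchOut; punchIn; splitAt; join; remQuot; combine; _↑ˡ_; _↑ʳ_)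
open import Data.Fin.Properties
  using (punchOut-injective; punchOut-cong; punchIn-injective; punchInᵢ≢i; any?; all?; ¬∀⟶∃¬; ¬Fin0;
         0≢1+n; suc-injective; join-splitAt; splitAt-↑ˡ; splitAt-↑ʳ; combine-remQuot)
  renaming (_≟_ to _≟ᶠ_)
open import Data.Fin.Subset using (Subset; _∈_; _⊆_; ⊤)
open import Data.Fin.Subset.Properties using (_∈?_; ∈⊤; ⊆-antisym)
open import Data.Vec using (tabulate)
open import Data.Vec.Properties using (lookup∘tabulate; []=⇒lookup; lookup⇒[]=)
open import Data.Bool using (true)
open import Data.Product using (Σ; ∃-syntax; _×_; _,_; proj₁; proj₂; uncurry)
open import Data.Product.Properties using (,-injectiveˡ; ,-injectiveʳ)
open import Data.Sum using (inj₁; inj₂)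
open import Function using (_∘_; _⇔_; mk⇔; Equivalence)
open import Function.Definitions using (Injective)
import Function.Construct.Composition as Composition
open import Relation.Nullary using (¬_; Dec; yes; no; does; contradiction)
open import Relation.Nullary.Decidable using (_×-dec_; ¬¬-excluded-middle; decidable-stable; dec-true; dec-false)
open import Relation.Binary.PropositionalEquality
  using (_≡_; _≢_; refl; trans; cong; cong₂; subst; module ≡-Reasoning)
  renaming (sym to ≡-sym)

-- Pairs (i , a) with a : Fin (f i) are encoded in Fin (sumF f) by placing the
-- blocks Fin (f 0), Fin (f 1), … side by side.  This is the palette of the
-- colouring of G glued from colourings of its components.
encodeΣ : ∀ {w} (f : Fin w → ℕ) → Σ (Fin w) (Fin ∘ f) → Fin (sumF f)
encodeΣ f (zero  , a) = a ↑ˡ sumF (f ∘ suc)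
encodeΣ f (suc i , a) = f zero ↑ʳ encodeΣ (f ∘ suc) (i , a)

decodeΣ : ∀ {w} (f : Fin w → ℕ) → Fin (sumF f) → Σ (Fin w) (Fin ∘ f)
decodeΣ {zero}  f ()
decodeΣ {suc w} f x with splitAt (f zero) x
... | inj₁ a = zero , a
... | inj₂ b = suc (proj₁ (decodeΣ (f ∘ suc) b)) , proj₂ (decodeΣ (f ∘ suc) b)

decode-encode : ∀ {w} (f : Fin w → ℕ) p → decodeΣ f (encodeΣ f p) ≡ p
decode-encode {suc w} f (zero , a)
  rewrite splitAt-↑ˡ (f zero) a (sumF (f ∘ suc)) = refl
decode-encode {suc w} f (suc i , a)
  rewrite splitAt-↑ʳ (f zero) (sumF (f ∘ suc)) (encodeΣ (f ∘ suc) (i , a))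
        | decode-encode (f ∘ suc) (i , a) = refl

join-splitAt-≡ : ∀ m {n} (x : Fin (m + n)) {s} → splitAt m x ≡ s → join m n s ≡ x
join-splitAt-≡ m x refl = join-splitAt m _ x

encode-decode : ∀ {w} (f : Fin w → ℕ) x → encodeΣ f (decodeΣ f x) ≡ x
encode-decode {suc w} f x with splitAt (f zero) x in eq
... | inj₁ a = join-splitAt-≡ (f zero) x eq
... | inj₂ b = trans (cong (f zero ↑ʳ_) (encode-decode (f ∘ suc) b)) (join-splitAt-≡ (f zero) x eq)

encode-injective : ∀ {w} (f : Fin w → ℕ) → Injective _≡_ _≡_ (encodeΣ f)
encode-injective f {p} {q} e = begin
  p                          ≡⟨ decode-encode f p ⟨
  decodeΣ f (encodeΣ f p)    ≡⟨ cong (decodeΣ f) e ⟩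
  decodeΣ f (encodeΣ f q)    ≡⟨ decode-encode f q ⟩
  q                          ∎
  where open ≡-Reasoning

-- A family of propositions over a finite type is decidable up to double
-- negation; this lets us use the (classically evident) decidability of
-- reachability when proving the decidable statement 'component' below.
¬¬-decidable : ∀ {m} (P : Fin m → Set) → ¬ ¬ (∀ u → Dec (P u))
¬¬-decidable {zero}  P k = k λ ()
¬¬-decidable {suc m} P k =
  ¬¬-excluded-middle λ d₀ → ¬¬-decidable (P ∘ suc) λ ds → k λ { zero → d₀ ; (suc u) → ds u }

module Reachability {n : ℕ} (G : Graph n) where

  reach-trans : ∀ {a b c} → Reach G a b → Reach G b c → Reach G a c
  reach-trans here       q = q
  reach-trans (step x p) q = step x (reach-trans p q)

  reach-sym : ∀ {a b} → Reach G a b → Reach G b a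
  reach-sym here       = here
  reach-sym (step x p) = reach-trans (reach-sym p) (step (Graph.sym G x) here)

  reachableFrom : ∀ {v} → (∀ u → Dec (Reach G v u)) → Subset n
  reachableFrom d = tabulate (does ∘ d)

  ∈reachableFrom : ∀ {v} (d : ∀ u → Dec (Reach G v u)) u → u ∈ reachableFrom d ⇔ Reach G v u
  ∈reachableFrom {v} d u = mk⇔ to from
    where
    decided-yes : u ∈ reachableFrom d → does (d u) ≡ true
    decided-yes m = trans (≡-sym (lookup∘tabulate (does ∘ d) u)) ([]=⇒lookup m)
    to : u ∈ reachableFrom d → Reach G v u
    to m = decidable-stable (d u) λ ¬r →
      contradiction (trans (≡-sym (decided-yes m)) (dec-false (d u) ¬r)) λ ()
    from : Reach G v u → u ∈ reachableFrom d
    from r = lookup⇒[]= u _ (trans (lookup∘tabulate (does ∘ d) u) (dec-true (d u) r))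

  reachableFrom-component : ∀ {v} (d : ∀ u → Dec (Reach G v u)) →
                            IsComponent G (reachableFrom d) × v ∈ reachableFrom d
  reachableFrom-component {v} d =
    (v , λ u → Equivalence.to (∈reachableFrom d u) , Equivalence.from (∈reachableFrom d u)) ,
    Equivalence.from (∈reachableFrom d v) here

module Components {n : ℕ} (G : Graph n) {ω : ℕ} {comp : Fin ω → Subset n}
                  (all-components : AllComponents G ω comp) where
  open Reachability G

  private
    isComponent : ∀ i → IsComponent G (comp i)
    isComponent = proj₁ all-components
    distinct : ∀ i j → comp i ≡ comp j → i ≡ j
    distinct = proj₁ (proj₂ all-components)
    exhaustive : ∀ S → IsComponent G S → ∃[ i ] comp i ≡ S
    exhaustive = proj₂ (proj₂ all-components)

  nonempty : ∀ i → ∃[ v ] v ∈ comp i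
  nonempty i = let (v , spec) = isComponent i in v , proj₂ (spec v) here

  connected : ∀ {i u w} → u ∈ comp i → w ∈ comp i → Reach G u w
  connected {i} {u} {w} u∈ w∈ =
    let (v , spec) = isComponent i
    in reach-trans (reach-sym (proj₁ (spec u) u∈)) (proj₁ (spec w) w∈)

  reach-closed : ∀ {i u w} → u ∈ comp i → Reach G u w → w ∈ comp i
  reach-closed {i} {u} {w} u∈ r =
    let (v , spec) = isComponent i
    in proj₂ (spec w) (reach-trans (proj₁ (spec u) u∈) r)

  adj-closed : ∀ {i u w} → u ∈ comp i → Adj G u w → w ∈ comp i
  adj-closed u∈ a = reach-closed u∈ (step a here)

  disjoint : ∀ {v i j} → v ∈ comp i → v ∈ comp j → i ≡ j
  disjoint {v} {i} {j} v∈i v∈j = distinct i j (⊆-antisym (included v∈i v∈j) (included v∈j v∈i))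
    where
    included : ∀ {i j} → v ∈ comp i → v ∈ comp j → comp i ⊆ comp j
    included v∈i v∈j x∈i = reach-closed v∈j (connected v∈i x∈i)

  -- Every vertex lies in some component.  The claim is decidable, so we may
  -- assume reachability from v decidable, and then its reachability set is a
  -- component, which appears in the list.
  component : ∀ v → ∃[ i ] v ∈ comp i
  component v = decidable-stable (any? λ i → v ∈? comp i) λ ¬in-some →
    ¬¬-decidable (Reach G v) λ d →
      let (isComp , v∈) = reachableFrom-component d
          (i , comp-i≡) = exhaustive _ isComp
      in ¬in-some (i , subst (v ∈_) (≡-sym comp-i≡) v∈)

  index : Fin n → Fin ω
  index v = proj₁ (component v)

  ∈index : ∀ v → v ∈ comp (index v)
  ∈index v = proj₂ (component v)

module Glue {n : ℕ} (G : Graph n) {ω : ℕ} {comp : Fin ω → Subset n}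
            (all-components : AllComponents G ω comp)
            (χs : Fin ω → ℕ) (tdcs : ∀ i → HasTDC G (comp i) (χs i)) where
  open Components G all-components

  colourIn : ∀ i → Fin n → Fin (χs i)
  colourIn i = proj₁ (tdcs i)

  tdcIn : ∀ i → IsTDC G (comp i) (χs i) (colourIn i)
  tdcIn i = proj₂ (tdcs i)

  glued : Fin n → Fin (sumF χs)
  glued v = encodeΣ χs (index v , colourIn (index v) v)

  glued-inverse : ∀ {u i a} → glued u ≡ encodeΣ χs (i , a) → u ∈ comp i × colourIn i u ≡ a
  glued-inverse {u} {i} {a} e
    with refl ← encode-injective χs {index u , colourIn (index u) u} {i , a} e = ∈index u , refl

  glued-in : ∀ {u i} → u ∈ comp i → glued u ≡ encodeΣ χs (i , colourIn i u)
  glued-in {u} u∈ = cong (λ i → encodeΣ χs (i , colourIn i u)) (disjoint (∈index u) u∈)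

  glued-isTDC : IsTDC G ⊤ (sumF χs) glued
  glued-isTDC = record
    { proper    = λ u v _ _ a e →
        let (u∈ , colour≡) = glued-inverse e
        in IsTDC.proper (tdcIn (index v)) u v u∈ (∈index v) a colour≡
    ; surj      = λ x →
        let (i , a) = decodeΣ χs x
            (u , u∈ , colour≡) = IsTDC.surj (tdcIn i) a
        in u , ∈⊤ , trans (glued-in u∈)
                          (trans (cong (λ b → encodeΣ χs (i , b)) colour≡) (encode-decode χs x))
    ; dominates = λ v _ →
        let (j , dom) = IsTDC.dominates (tdcIn (index v)) v (∈index v)
        in encodeΣ χs (index v , j) , λ u _ e →
             let (u∈ , colour≡) = glued-inverse e in dom u u∈ colour≡
    }

module Loose {n : ℕ} (G : Graph n) (S : Subset n) where

  Used : ∀ {k} → (Fin n → Fin k) → Fin k → Set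
  Used c j = ∃[ u ] (u ∈ S × c u ≡ j)

  used? : ∀ {k} (c : Fin n → Fin k) j → Dec (Used c j)
  used? c j = any? λ u → (u ∈? S) ×-dec (c u ≟ᶠ j)

  -- A TDC of G[S] except that colours need not occur on S; the dominated
  -- classes are required to be nonempty, so domination is not vacuous.
  record IsLooseTDC {k : ℕ} (c : Fin n → Fin k) : Set where
    field
      proper    : ∀ u v → u ∈ S → v ∈ S → Adj G u v → c u ≢ c v
      dominates : ∀ v → v ∈ S → ∃[ j ] (Used c j × (∀ u → u ∈ S → c u ≡ j → Adj G v u))

  loose⇒TDC : ∀ {k} {c : Fin n → Fin k} → IsLooseTDC c → (∀ j → Used c j) → IsTDC G S k c
  loose⇒TDC loose all-used = record
    { proper    = IsLooseTDC.proper loose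
    ; surj      = all-used
    ; dominates = λ v v∈ → let (j , _ , dom) = IsLooseTDC.dominates loose v v∈ in j , dom }

  -- Deleting a colour j unused on S: the remaining colours are renumbered by
  -- 'punchOut j'.  Off S the new colour is irrelevant; we use that of s ∈ S.
  module DropColour {k : ℕ} {s : Fin n} (s∈S : s ∈ S) (c : Fin n → Fin (suc k))
                    (j : Fin (suc k)) (j-unused : ¬ Used c j) where

    j≢colour : ∀ {u} → u ∈ S → j ≢ c u
    j≢colour u∈ j≡ = j-unused (_ , u∈ , ≡-sym j≡)

    recolour : Fin n → Fin k
    recolour u with c u ≟ᶠ j
    ... | yes _   = punchOut (j≢colour s∈S)
    ... | no cu≢j = punchOut (cu≢j ∘ ≡-sym)

    recolour-on-S : ∀ {u} → u ∈ S → (q : j ≢ c u) → recolour u ≡ punchOut q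
    recolour-on-S {u} u∈ q with c u ≟ᶠ j
    ... | yes cu≡j = contradiction (_ , u∈ , cu≡j) j-unused
    ... | no _     = punchOut-cong j refl

    recolour-sound : ∀ {u x} → u ∈ S → (q : j ≢ x) → recolour u ≡ punchOut q → c u ≡ x
    recolour-sound u∈ q e = punchOut-injective (j≢colour u∈) q (trans (≡-sym (recolour-on-S u∈ _)) e)

    recolour-complete : ∀ {u x} → u ∈ S → (q : j ≢ x) → c u ≡ x → recolour u ≡ punchOut q
    recolour-complete u∈ q refl = recolour-on-S u∈ q

    recolour-loose : IsLooseTDC c → IsLooseTDC recolour
    recolour-loose loose = record
      { proper    = λ u v u∈ v∈ a e →
          IsLooseTDC.proper loose u v u∈ v∈ a
            (recolour-sound u∈ (j≢colour v∈) (trans e (recolour-on-S v∈ _)))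
      ; dominates = λ v v∈ →
          let (i , (w , w∈ , cw≡i) , dom) = IsLooseTDC.dominates loose v v∈
              j≢i : j ≢ i
              j≢i j≡i = j-unused (w , w∈ , trans cw≡i (≡-sym j≡i))
          in punchOut j≢i , (w , w∈ , recolour-complete w∈ j≢i cw≡i) ,
             λ u u∈ e → dom u u∈ (recolour-sound u∈ j≢i e)
      }

    recolour-unused : ∀ {x} → ¬ Used c x → (q : j ≢ x) → ¬ Used recolour (punchOut q)
    recolour-unused x-unused q (u , u∈ , e) = x-unused (u , u∈ , recolour-sound u∈ q e)

  discardUnused : ∀ {s} → s ∈ S → ∀ r {k} (c : Fin n → Fin k) → IsLooseTDC c →
                  (g : Fin r → Fin k) → Injective _≡_ _≡_ g → (∀ t → ¬ Used c (g t)) →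
                  ∃[ k' ] ∃[ c' ] (IsLooseTDC {k'} c' × k' + r ≡ k)
  discardUnused     s∈S zero    {k}    c loose _ _ _ = k , c , loose , +-identityʳ k
  discardUnused {s} s∈S (suc r) {zero} c _     _ _ _ = contradiction (c s) ¬Fin0
  discardUnused s∈S (suc r) {suc k} c loose g g-inj g-unused =
    let (k' , c' , loose' , k'+r≡k) = discardUnused s∈S r recolour (recolour-loose loose) g' g'-inj g'-unused
    in k' , c' , loose' , trans (+-suc k' r) (cong suc k'+r≡k)
    where
    open DropColour s∈S c (g zero) (g-unused zero)
    g₀≢ : ∀ t → g zero ≢ g (suc t)
    g₀≢ t = 0≢1+n ∘ g-inj
    g' : Fin r → Fin k
    g' t = punchOut (g₀≢ t)
    g'-inj : Injective _≡_ _≡_ g'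
    g'-inj e = suc-injective (g-inj (punchOut-injective (g₀≢ _) (g₀≢ _) e))
    g'-unused : ∀ t → ¬ Used recolour (g' t)
    g'-unused t = recolour-unused (g-unused (suc t)) (g₀≢ t)

  tighten : ∀ {s} → s ∈ S → ∀ {k} (c : Fin n → Fin k) → IsLooseTDC c →
            ∃[ k' ] (HasTDC G S k' × k' ≤ k)
  tighten {s} s∈S {zero} c _ = contradiction (c s) ¬Fin0
  tighten s∈S {suc k} c loose with all? (used? c)
  ... | yes all-used = suc k , (c , loose⇒TDC loose all-used) , ≤-refl
  ... | no ¬all-used =
    let (j , j-unused) = ¬∀⟶∃¬ _ (Used c) (used? c) ¬all-used
        open DropColour s∈S c j j-unused
        (k' , tdc , k'≤k) = tighten s∈S recolour (recolour-loose loose)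
    in k' , tdc , m≤n⇒m≤1+n k'≤k

  shrink : ∀ {s} → s ∈ S → ∀ {k r} (c : Fin n → Fin k) → IsLooseTDC c →
           (g : Fin r → Fin k) → Injective _≡_ _≡_ g → (∀ t → ¬ Used c (g t)) →
           ∃[ k' ] (HasTDC G S k' × k' + r ≤ k)
  shrink s∈S {r = r} c loose g g-inj g-unused =
    let (k₁ , c₁ , loose₁ , k₁+r≡k) = discardUnused s∈S r c loose g g-inj g-unused
        (k' , tdc , k'≤k₁) = tighten s∈S c₁ loose₁
    in k' , tdc , ≤-trans (+-monoˡ-≤ r k'≤k₁) (≤-reflexive k₁+r≡k)

module PrivateColours {n : ℕ} (G : Graph n) {ω : ℕ} {comp : Fin ω → Subset n}
                      (all-components : AllComponents G ω comp)
                      {χ : ℕ} {c : Fin n → Fin χ} (tdc : IsTDC G ⊤ χ c) where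
  open Components G all-components

  PrivateTo : Fin ω → Fin χ → Set
  PrivateTo i a = ∀ w → c w ≡ a → w ∈ comp i

  -- Every colour class is nonempty, so it is private to at most one component.
  private-unique : ∀ {i i' a} → PrivateTo i a → PrivateTo i' a → i ≡ i'
  private-unique {a = a} p p' = let (w , _ , cw≡a) = IsTDC.surj tdc a in disjoint (p w cw≡a) (p' w cw≡a)

  dominated : Fin n → Fin χ
  dominated v = proj₁ (IsTDC.dominates tdc v ∈⊤)

  dominated-adj : ∀ {v u} → c u ≡ dominated v → Adj G v u
  dominated-adj {v} {u} = proj₂ (IsTDC.dominates tdc v ∈⊤) u ∈⊤

  dominated-private : ∀ {i v} → v ∈ comp i → PrivateTo i (dominated v)
  dominated-private v∈ w cw≡ = adj-closed v∈ (dominated-adj cw≡)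

  member : Fin χ → Fin n
  member a = proj₁ (IsTDC.surj tdc a)

  member-colour : ∀ a → c (member a) ≡ a
  member-colour a = proj₂ (proj₂ (IsTDC.surj tdc a))

  privatePair : Fin ω → Fin 2 → Fin χ
  privatePair i zero       = dominated (proj₁ (nonempty i))
  privatePair i (suc zero) = dominated (member (privatePair i zero))

  privatePair-private : ∀ i x → PrivateTo i (privatePair i x)
  privatePair-private i zero       = dominated-private (proj₂ (nonempty i))
  privatePair-private i (suc zero) =
    dominated-private (privatePair-private i zero _ (member-colour (privatePair i zero)))

  -- The two private colours differ, as no vertex is adjacent to itself.
  privatePair-distinct : ∀ i → privatePair i zero ≢ privatePair i (suc zero)
  privatePair-distinct i e = Graph.irrefl G (dominated-adj (trans (member-colour _) e))

  privatePair-injectiveʳ : ∀ i {x x'} → privatePair i x ≡ privatePair i x' → x ≡ x'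
  privatePair-injectiveʳ i {zero}     {zero}     _ = refl
  privatePair-injectiveʳ i {zero}     {suc zero} e = contradiction e (privatePair-distinct i)
  privatePair-injectiveʳ i {suc zero} {zero}     e = contradiction (≡-sym e) (privatePair-distinct i)
  privatePair-injectiveʳ i {suc zero} {suc zero} _ = refl

  privatePair-injective : Injective _≡_ _≡_ (uncurry privatePair)
  privatePair-injective {i , x} {i' , x'} e
    with refl ← private-unique (privatePair-private i x)
                               (subst (PrivateTo i') (≡-sym e) (privatePair-private i' x'))
    = cong (i ,_) (privatePair-injectiveʳ i e)

  -- Restricted to a component, c is a loose TDC: the class dominated by a
  -- vertex lies in the vertex's component.
  restriction-loose : ∀ i → Loose.IsLooseTDC G (comp i) c
  restriction-loose i = record
    { proper    = λ u v _ _ → IsTDC.proper tdc u v ∈⊤ ∈⊤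
    ; dominates = λ v v∈ →
        dominated v , (member (dominated v) , dominated-private v∈ _ (member-colour _) , member-colour _) ,
        λ u _ → dominated-adj
    }

  private-elsewhere-unused : ∀ {i i' a} → i' ≢ i → PrivateTo i' a → ¬ Loose.Used G (comp i) c a
  private-elsewhere-unused i'≢i p (u , u∈ , cu≡a) = i'≢i (disjoint (p u cu≡a) u∈)

remQuot-injective : ∀ {m} k → Injective _≡_ _≡_ (remQuot {m} k)
remQuot-injective {m} k {z} {z'} e = begin
  z                                  ≡⟨ combine-remQuot {m} k z ⟨
  uncurry combine (remQuot {m} k z)  ≡⟨ cong (uncurry combine) e ⟩
  uncurry combine (remQuot {m} k z') ≡⟨ combine-remQuot {m} k z' ⟩
  z'                                 ∎
  where open ≡-Reasoning

-- Lower bound for a single component m of a graph with ω' + 1 components: the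
-- 2ω' colours private to the other components can be deleted from c.
componentBound : ∀ {n} (G : Graph n) {ω'} {comp : Fin (suc ω') → Subset n} →
                 AllComponents G (suc ω') comp → ∀ {χ} → HasTDC G ⊤ χ →
                 ∀ m {χm} → IsTDChromatic G (comp m) χm → χm + ω' * 2 ≤ χ
componentBound G {ω'} {comp} all-components {χ} (c , tdc) m (_ , χm-minimal) =
  let (s , s∈) = nonempty m
      (k , tdc-m , k+r≤χ) = shrink s∈ c (restriction-loose m) others others-injective others-unused
  in ≤-trans (+-monoˡ-≤ (ω' * 2) (χm-minimal k tdc-m)) k+r≤χ
  where
  open Components G all-components
  open PrivateColours G all-components tdc
  open Loose G (comp m)

  others : Fin (ω' * 2) → Fin χ
  others = uncurry privatePair ∘ (λ (t , x) → punchIn m t , x) ∘ remQuot 2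

  others-injective : Injective _≡_ _≡_ others
  others-injective = Composition.injective _≡_ _≡_ _≡_ (remQuot-injective 2)
    (Composition.injective _≡_ _≡_ _≡_ punchIn-pair-injective privatePair-injective)
    where
    punchIn-pair-injective : Injective _≡_ _≡_ (λ ((t , x) : Fin ω' × Fin 2) → punchIn m t , x)
    punchIn-pair-injective {t , x} {t' , x'} e =
      cong₂ _,_ (punchIn-injective m t t' (,-injectiveˡ e)) (,-injectiveʳ e)

  others-unused : ∀ z → ¬ Used c (others z)
  others-unused z =
    let (t , x) = remQuot 2 z
    in private-elsewhere-unused (punchInᵢ≢i m t) (privatePair-private (punchIn m t) x)

maxF-attained : ∀ {w} (f : Fin (suc w) → ℕ) → ∃[ m ] maxF f ≤ f m
maxF-attained {zero}  f = zero , ≤-reflexive (⊔-identityʳ (f zero))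
maxF-attained {suc w} f with ⊔-sel (f zero) (maxF (f ∘ suc))
... | inj₁ max≡f₀ = zero , ≤-reflexive max≡f₀
... | inj₂ max≡rest =
  let (m , rest≤) = maxF-attained (f ∘ suc) in suc m , ≤-trans (≤-reflexive max≡rest) rest≤

twice-suc : ∀ x w → x + 2 * suc w ≡ x + w * 2 + 2
twice-suc = solve 2 (λ x w → x :+ con 2 :* (con 1 :+ w) := x :+ w :* con 2 :+ con 2) refl
  where open +-*-Solver

upperBound : ∀ {n} (G : Graph n) {ω} {comp : Fin ω → Subset n} → AllComponents G ω comp →
             (χs : Fin ω → ℕ) → (∀ i → HasTDC G (comp i) (χs i)) →
             ∀ {χ} → IsTDChromaticG G χ → χ ≤ sumF χs
upperBound G all-components χs tdcs (_ , χ-minimal) =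
  χ-minimal (sumF χs) (_ , Glue.glued-isTDC G all-components χs tdcs)

lowerBound : ∀ {n} (G : Graph n) {ω} {comp : Fin ω → Subset n} → AllComponents G ω comp →
             (χs : Fin ω → ℕ) → (∀ i → IsTDChromatic G (comp i) (χs i)) →
             ∀ {χ} → HasTDC G ⊤ χ → maxF χs + 2 * ω ≤ χ + 2
lowerBound G {zero}   _              _  _         _   = z≤n
lowerBound G {suc ω'} all-components χs chromatic {χ} tdc =
  let (m , max≤χm) = maxF-attained χs
  in begin
    maxF χs + 2 * suc ω' ≡⟨ twice-suc (maxF χs) ω' ⟩
    maxF χs + ω' * 2 + 2 ≤⟨ +-monoˡ-≤ 2 (+-monoˡ-≤ (ω' * 2) max≤χm) ⟩
    χs m + ω' * 2 + 2    ≤⟨ +-monoˡ-≤ 2 (componentBound G all-components tdc m (chromatic m)) ⟩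
    χ + 2                ∎
  where open ≤-Reasoning

theorem3p2 : ∀ {n} (G : Graph n) → NoIsolated G →
    (ω : ℕ) (comp : Fin ω → Subset n) → AllComponents G ω comp →
    (χs : Fin ω → ℕ) → (∀ i → IsTDChromatic G (comp i) (χs i)) →
    (χ : ℕ) → IsTDChromaticG G χ →
    (maxF χs + 2 * ω ≤ χ + 2) × (χ ≤ sumF χs)
theorem3p2 G _ ω comp all-components χs chromatic χ isχ =
  lowerBound G all-components χs chromatic (proj₁ isχ) ,
  upperBound G all-components χs (proj₁ ∘ chromatic) isχ
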